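{- Let $(M,\mathcal{X})$, $\mathcal{X}=(X_x)_{x\in V(M)}$, be a median decomposition of a graph $G$, and let $ab$ and $cd$ be edges of $M$ whose $\Theta$-classes $F_{ab}$ and $F_{cd}$ are laminar. Then the separations $(Y_{ab},Y_{ba})$ and $(Y_{cd},Y_{dc})$ of $G$ are laminar.
   Context: All graphs are finite, simple and undirected. For vertices $u,v$ of a connected graph, $I(u,v)$ is the set of vertices on shortest $(u,v)$-paths; a vertex set $S$ is convex if $I(u,v)\subseteq S$ for all $u,v\in S$. A median graph is a connected graph $M$ with $|I(u,v)\cap I(v,w)\cap I(w,u)|=1$ for all vertices $u,v,w$. A median decomposition of $G$ is a pair $(M,\mathcal{X})$ with $M$ a median graph and $\mathcal{X}=(X_x)_{x\in V(M)}$ subsets of $V(G)$ such that (M1) every edge of $G$ has both ends in some $X_x$, and (M2) for every $v\in V(G)$, $X^{ -1}(v)=\{x: v\in X_x\}$ is non-empty and convex in $M$. For an edge $ab$ of $M$: $W_{ab}=\{v\in V(M): d(v,a)<d(v,b)\}$ (in a median graph $V(M)$ is the disjoint union of $W_{ab}$ and $W_{ba}$), $F_{ab}$ is the set of edges between $W_{ab}$ and $W_{ba}$ (the $\Theta$-class of $ab$), and $Y_{ab}=\bigcup_{x\in W_{ab}}X_x$; $(Y_{ab},Y_{ba})$ is a separation of $G$. Two $\Theta$-classes $F_{x_1x_2},F_{x'_1x'_2}$ are laminar if there are $i,j\in\{1,2\}$ with $W_{x_ix_{3-i}}\subseteq W_{x'_jx'_{3-j}}$ and $W_{x_{3-i}x_i}\subseteq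 W_{x'_{3-j}x'_j}$. A separation of $G$ is a pair $(A,B)$ with $A\cup B=V(G)$ and no edge between $A\setminus B$ and $B\setminus A$; two separations $(U_1,U_2),(W_1,W_2)$ are laminar if there are $i,j\in\{1,2\}$ with $U_i\subseteq W_j$ and $U_{3-i}\supseteq W_{3-j}$. -}

module Defs where

open import Level using (0ℓ)
open import Data.Nat using (ℕ; zero; suc; _+_; _≤_; _<_)
open import Data.Fin using (Fin)
open import Data.Bool using (Bool; T)
open import Data.Product using (Σ; ∃; ∃-syntax; _×_; _,_)
open import Data.Sum using (_⊎_)
open import Relation.Unary using (Pred; _⊆_)
open import Relation.Binary.PropositionalEquality using (_≡_)
open import Relation.Nullary using (¬_)

record Graph (n : ℕ) : Set where
  field
    adj    : Fin n → Fin n → Bool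
    sym    : ∀ u v → adj u v ≡ adj v u
    irrefl : ∀ u → ¬ T (adj u u)
open Graph public

module _ {n : ℕ} (G : Graph n) where

  Edge : Fin n → Fin n → Set
  Edge u v = T (adj G u v)

  data Walk : Fin n → Fin n → ℕ → Set where
    stay : ∀ u → Walk u u zero
    step : ∀ {u w v k} → Edge u w → Walk w v k → Walk u v (suc k)

  IsDist : Fin n → Fin n → ℕ → Set
  IsDist u v k = Walk u v k × (∀ m → Walk u v m → k ≤ m)

  Connected : Set
  Connected = ∀ u v → ∃[ k ] Walk u v k

  InI : Fin n → Fin n → Pred (Fin n) 0ℓ
  InI u v w = ∃[ k₁ ] ∃[ k₂ ] (Walk u w k₁ × Walk w v k₂ × IsDist u v (k₁ + k₂))

  Convex : Pred (Fin n) 0ℓ → Set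
  Convex S = ∀ u v → S u → S v → InI u v ⊆ S

  IsMedian : Set
  IsMedian = Connected ×
    (∀ u v w → ∃[ x ] ((InI u v x × InI v w x × InI w u x) ×
                       (∀ y → InI u v y → InI v w y → InI w u y → y ≡ x)))

  W : Fin n → Fin n → Pred (Fin n) 0ℓ
  W a b v = ∃[ k ] ∃[ l ] (IsDist v a k × IsDist v b l × k < l)

record IsMedianDecomposition {n m : ℕ} (G : Graph n) (M : Graph m)
                             (X : Fin m → Fin n → Bool) : Set where
  field
    median : IsMedian M
    M1     : ∀ u v → Edge G u v → ∃[ x ] (T (X x u) × T (X x v))
    M2-ne  : ∀ v → ∃[ x ] T (X x v)
    M2-cvx : ∀ v → Convex M (λ x → T (X x v))

Y : {n m : ℕ} (M : Graph m) (X : Fin m → Fin n → Bool) → Fin m → Fin m → Pred (Fin n) 0ℓ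
Y M X a b v = ∃[ x ] (W M a b x × T (X x v))

-- Θ-classes F_{x1x2}, F_{x1'x2'} laminar: ∃ i j ∈ {1,2},
-- W_{x_i x_{3-i}} ⊆ W_{x'_j x'_{3-j}} and W_{x_{3-i} x_i} ⊆ W_{x'_{3-j} x'_j}.
ΘLaminar : {m : ℕ} (M : Graph m) → Fin m → Fin m → Fin m → Fin m → Set
ΘLaminar M x₁ x₂ y₁ y₂ =
    (W M x₁ x₂ ⊆ W M y₁ y₂ × W M x₂ x₁ ⊆ W M y₂ y₁)
  ⊎ (W M x₁ x₂ ⊆ W M y₂ y₁ × W M x₂ x₁ ⊆ W M y₁ y₂)
  ⊎ (W M x₂ x₁ ⊆ W M y₁ y₂ × W M x₁ x₂ ⊆ W M y₂ y₁)
  ⊎ (W M x₂ x₁ ⊆ W M y₂ y₁ × W M x₁ x₂ ⊆ W M y₁ y₂)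

SepLaminar : {n : ℕ} → (U₁ U₂ W₁ W₂ : Pred (Fin n) 0ℓ) → Set
SepLaminar U₁ U₂ W₁ W₂ =
    (U₁ ⊆ W₁ × W₂ ⊆ U₂)
  ⊎ (U₁ ⊆ W₂ × W₁ ⊆ U₂)
  ⊎ (U₂ ⊆ W₁ × W₂ ⊆ U₁)
  ⊎ (U₂ ⊆ W₂ × W₁ ⊆ U₁)

-- Along an edge ab of a median graph no vertex v is equidistant from a and
-- b: the median of v, a, b lies in I(a,b) = {a, b}, and if it is, say, a,
-- then a ∈ I(b,v) forces d(b,v) = 1 + d(a,v). Hence W_ab and W_ba
-- partition V(M), so any inclusion W_ab ⊆ W_cd already yields the reverse
-- inclusion W_dc ⊆ W_ba of complements. Since Y is monotone in W, both
-- inclusions required of the separations follow.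
module Submission where

open import Defs
open import Level using (0ℓ)
open import Data.Nat using (ℕ; zero; suc; _+_; _≤_; _<_; s≤s)
open import Data.Nat.Properties
  using (anyUpTo?; ≮⇒≥; ≤-antisym; ≤-trans; <-trans; <-irrefl; <-cmp; +-comm; m+n≮n; m+n≤o⇒n≤o)
open import Data.Nat.Induction using (<-rec)
open import Data.Fin using (Fin)
open import Data.Fin.Properties using (any?) renaming (_≟_ to _≟ᶠ_)
open import Data.Bool using (Bool; T)
open import Data.Product using (∃-syntax; _×_; _,_; proj₁; proj₂)
open import Data.Sum using (_⊎_; inj₁; inj₂)
open import Data.Empty using (⊥; ⊥-elim)
open import Relation.Nullary using (Dec; yes; no)
open import Relation.Nullary.Decidable using (T?; _×-dec_)
open import Relation.Unary using (Pred; Decidable; _⊆_)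
open import Relation.Binary using (tri<; tri≈; tri>)
open import Relation.Binary.PropositionalEquality using (_≡_; refl; subst) renaming (sym to ≡-sym)

least-witness : {P : Pred ℕ 0ℓ} → Decidable P →
                ∀ k → P k → ∃[ j ] (P j × (∀ i → P i → j ≤ i))
least-witness {P} P? = <-rec _ search
  where
  search : ∀ k → (∀ {i} → i < k → P i → ∃[ j ] (P j × (∀ i → P i → j ≤ i))) →
           P k → ∃[ j ] (P j × (∀ i → P i → j ≤ i))
  search k smaller Pk with anyUpTo? P? k
  ... | yes (i , i<k , Pi) = smaller i<k Pi
  ... | no none            = k , Pk , λ i Pi → ≮⇒≥ (λ i<k → none (i , i<k , Pi))

module _ {m : ℕ} (M : Graph m) where

  Edge-sym : ∀ {u v} → Edge M u v → Edge M v u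
  Edge-sym {u} {v} = subst T (Graph.sym M u v)

  Edge-irrefl : ∀ {u v} → Edge M u v → u ≡ v → ⊥
  Edge-irrefl e refl = Graph.irrefl M _ e

  Walk-snoc : ∀ {u w v k} → Walk M u w k → Edge M w v → Walk M u v (suc k)
  Walk-snoc (stay _)   e = step e (stay _)
  Walk-snoc (step f p) e = step f (Walk-snoc p e)

  Walk-reverse : ∀ {u v k} → Walk M u v k → Walk M v u k
  Walk-reverse (stay u)   = stay u
  Walk-reverse (step e p) = Walk-snoc (Walk-reverse p) (Edge-sym e)

  Walk? : ∀ k u v → Dec (Walk M u v k)
  Walk? zero u v with u ≟ᶠ v
  ... | yes refl = yes (stay u)
  ... | no u≢v   = no λ { (stay _) → u≢v refl }
  Walk? (suc k) u v with any? (λ w → T? (Graph.adj M u w) ×-dec Walk? k w v)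
  ... | yes (w , e , p) = yes (step e p)
  ... | no none         = no λ { (step {w = w} e p) → none (w , e , p) }

  IsDist-exists : ∀ {u v k} → Walk M u v k → ∃[ d ] IsDist M u v d
  IsDist-exists p = least-witness (λ k → Walk? k _ _) _ p

  IsDist-unique : ∀ {u v k l} → IsDist M u v k → IsDist M u v l → k ≡ l
  IsDist-unique (p , minₖ) (q , minₗ) = ≤-antisym (minₖ _ q) (minₗ _ p)

  IsDist-sym : ∀ {u v k} → IsDist M u v k → IsDist M v u k
  IsDist-sym (p , minimal) = Walk-reverse p , λ l q → minimal l (Walk-reverse q)

  InI-sym : ∀ {u v w} → InI M u v w → InI M v u w
  InI-sym (k₁ , k₂ , p , q , d) =
    k₂ , k₁ , Walk-reverse q , Walk-reverse p ,
    subst (IsDist M _ _) (+-comm k₁ k₂) (IsDist-sym d)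

  InI-equidistant⇒≡ : ∀ {u v w k} → InI M u v w →
                      IsDist M u v k → IsDist M w v k → u ≡ w
  InI-equidistant⇒≡ (_ , _ , stay _ , _ , _) _ _ = refl
  InI-equidistant⇒≡ (suc k₁ , k₂ , step _ _ , q , _ , shortest) (p , _) (_ , min-w) =
    ⊥-elim (m+n≮n k₁ k₂ (≤-trans (shortest _ p) (min-w k₂ q)))

  InI-edge : ∀ {a b x} → Edge M a b → InI M a b x → x ≡ a ⊎ x ≡ b
  InI-edge e (_ , _ , stay _ , _ , _) = inj₁ refl
  InI-edge e (_ , _ , step _ _ , stay _ , _) = inj₂ refl
  InI-edge e (suc k₁ , suc k₂ , step _ _ , step _ _ , _ , minimal)
    with minimal 1 (step e (stay _))
  ... | s≤s k₁+1+k₂≤0 with m+n≤o⇒n≤o k₁ k₁+1+k₂≤0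
  ... | ()

  W-disjoint : ∀ {a b v} → W M a b v → W M b a v → ⊥
  W-disjoint (k , l , da , db , k<l) (l′ , k′ , db′ , da′ , l′<k′)
    rewrite IsDist-unique da′ da | IsDist-unique db′ db =
    <-irrefl refl (<-trans k<l l′<k′)

  module _ (median : IsMedian M) where

    Edge⇒not-equidistant : ∀ {a b v k} → Edge M a b →
                           IsDist M v a k → IsDist M v b k → ⊥
    Edge⇒not-equidistant {a} {b} {v} e da db with proj₂ median v a b
    ... | x , (x∈Iva , x∈Iab , x∈Ibv) , _ with InI-edge e x∈Iab
    ... | inj₁ refl = Edge-irrefl e
          (≡-sym (InI-equidistant⇒≡ x∈Ibv (IsDist-sym db) (IsDist-sym da)))
    ... | inj₂ refl = Edge-irrefl e
          (InI-equidistant⇒≡ (InI-sym x∈Iva) (IsDist-sym da) (IsDist-sym db))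

    W-partition : ∀ {a b} → Edge M a b → ∀ v → W M a b v ⊎ W M b a v
    W-partition e v
      with IsDist-exists (proj₂ (proj₁ median v _)) | IsDist-exists (proj₂ (proj₁ median v _))
    ... | k , da | l , db with <-cmp k l
    ... | tri< k<l _ _  = inj₁ (k , l , da , db , k<l)
    ... | tri≈ _ refl _ = ⊥-elim (Edge⇒not-equidistant e da db)
    ... | tri> _ _ l<k  = inj₂ (l , k , db , da , l<k)

    W-complement-⊆ : ∀ {a b c d} → Edge M a b →
                     W M a b ⊆ W M c d → W M d c ⊆ W M b a
    W-complement-⊆ e Wab⊆Wcd {v} v∈Wdc with W-partition e v
    ... | inj₁ v∈Wab = ⊥-elim (W-disjoint (Wab⊆Wcd v∈Wab) v∈Wdc)
    ... | inj₂ v∈Wba = v∈Wba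

Y-mono : ∀ {n m} (M : Graph m) (X : Fin m → Fin n → Bool) {a b c d} →
         W M a b ⊆ W M c d → Y M X a b ⊆ Y M X c d
Y-mono M X Wab⊆Wcd (x , x∈Wab , v∈Xx) = x , Wab⊆Wcd x∈Wab , v∈Xx

Y-nested : ∀ {n m} (M : Graph m) (X : Fin m → Fin n → Bool) → IsMedian M →
           ∀ {a b c d} → Edge M a b → W M a b ⊆ W M c d →
           Y M X a b ⊆ Y M X c d × Y M X d c ⊆ Y M X b a
Y-nested M X median e Wab⊆Wcd =
  Y-mono M X Wab⊆Wcd , Y-mono M X (W-complement-⊆ M median e Wab⊆Wcd)

lemma5p5 : {n m : ℕ} (G : Graph n) (M : Graph m) (X : Fin m → Fin n → Bool) →
    IsMedianDecomposition G M X →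
    (a b c d : Fin m) → Edge M a b → Edge M c d →
    ΘLaminar M a b c d →
    SepLaminar (Y M X a b) (Y M X b a) (Y M X c d) (Y M X d c)
lemma5p5 G M X D a b c d eab _ = λ where
    (inj₁ (Wab⊆Wcd , _))               → inj₁ (nested eab Wab⊆Wcd)
    (inj₂ (inj₁ (Wab⊆Wdc , _)))        → inj₂ (inj₁ (nested eab Wab⊆Wdc))
    (inj₂ (inj₂ (inj₁ (Wba⊆Wcd , _)))) → inj₂ (inj₂ (inj₁ (nested (Edge-sym M eab) Wba⊆Wcd)))
    (inj₂ (inj₂ (inj₂ (Wba⊆Wdc , _)))) → inj₂ (inj₂ (inj₂ (nested (Edge-sym M eab) Wba⊆Wdc)))
  where
  nested : ∀ {p q r s} → Edge M p q → W M p q ⊆ W M r s →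
           Y M X p q ⊆ Y M X r s × Y M X s r ⊆ Y M X q p
  nested = Y-nested M X (IsMedianDecomposition.median D)
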